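{- For every integer $n\ge0$ and every vertex $v$ of $\mathbb{Z}^2$, the number of closed non-backtracking walks of length $2n$ from $v$ to itself in $\mathbb{Z}^2$ equals \[ \sum_{i=0}^{n}(-3)^i\binom{2n-i}{i}\binom{2n-2i}{n-i}^2 - \sum_{i=0}^{n-1}(-3)^i\binom{2n-i-2}{i}\binom{2n-2i-2}{n-i-1}^2, \] which can equivalently be written as \[ \sum_{k=0}^n (-3)^{n-k}\binom{n+k}{2k}\binom{2k}{k}^2 - \sum_{k=1}^{n}(-3)^{n-k}\binom{n+k-2}{2k-2}\binom{2k-2}{k-1}^2. \]
   Context: $\mathbb{Z}^2$ is the infinite grid graph (vertices $\mathbb{Z}^2$, adjacent iff at Euclidean distance $1$). A closed non-backtracking walk of length $m$ from $v$ to itself is a sequence $(v_0,\dots,v_m)$ with $v_0=v_m=v$, consecutive vertices adjacent, and $v_{i+1}\neq v_{i-1}$ for $1\le i<m$. -}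

module Defs where

open import Data.Nat as ℕ using (ℕ; zero; suc; _∸_)
open import Data.Nat.Combinatorics using (_C_)
open import Data.Integer as ℤ using (ℤ; +_; -[1+_]; _-_)
open import Data.Product using (_×_; Σ)
open import Data.Fin using (Fin; zero; suc; fromℕ; inject₁; toℕ)
open import Data.Vec using (Vec; lookup)
open import Data.List using (List; length; map; upTo; foldr)
open import Data.List.Relation.Unary.Unique.Propositional using (Unique)
open import Data.List.Membership.Propositional using (_∈_)
open import Function.Bundles using (_⇔_)
open import Relation.Binary.PropositionalEquality using (_≡_; _≢_)

V : Set
V = ℤ × ℤ

Adj : V → V → Set
Adj (a Data.Product., b) (c Data.Product., d) =
  ((a - c) ℤ.* (a - c)) ℤ.+ ((b - d) ℤ.* (b - d)) ≡ + 1

ClosedNBWalk : V → (m : ℕ) → Vec V (suc m) → Set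
ClosedNBWalk v m w =
  (lookup w zero ≡ v) ×
  (lookup w (fromℕ m) ≡ v) ×
  ((i : Fin m) → Adj (lookup w (inject₁ i)) (lookup w (suc i))) ×
  -- v_{i+1} ≠ v_{i-1} for 1 ≤ i < m, i.e. v_j ≠ v_k whenever j = k + 2
  ((j k : Fin (suc m)) → toℕ j ≡ 2 ℕ.+ toℕ k → lookup w j ≢ lookup w k)

-- "The set {x | P x} is finite with exactly N elements":
-- there is a duplicate-free list of length N whose members are exactly the x with P x.
HasCount : {A : Set} → (A → Set) → ℕ → Set
HasCount {A} P N = Σ (List A) λ L → Unique L × ((x : A) → (x ∈ L) ⇔ P x) × (length L ≡ N)

sumℤ : ℕ → (ℕ → ℤ) → ℤ
sumℤ n f = foldr ℤ._+_ (+ 0) (map f (upTo n))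

-3ℤ : ℤ
-3ℤ = -[1+ 2 ]

sq : ℕ → ℕ
sq x = x ℕ.* x

formula₁ : ℕ → ℤ
formula₁ n =
  sumℤ (suc n) (λ i → (-3ℤ ℤ.^ i) ℤ.* + (((2 ℕ.* n ∸ i) C i) ℕ.* sq ((2 ℕ.* n ∸ 2 ℕ.* i) C (n ∸ i))))
  - sumℤ n (λ i → (-3ℤ ℤ.^ i) ℤ.* + (((2 ℕ.* n ∸ i ∸ 2) C i) ℕ.* sq ((2 ℕ.* n ∸ 2 ℕ.* i ∸ 2) C (n ∸ i ∸ 1))))

-- Second form (second sum over k = 1..n, written with k = j + 1)
formula₂ : ℕ → ℤ
formula₂ n =
  sumℤ (suc n) (λ k → (-3ℤ ℤ.^ (n ∸ k)) ℤ.* + (((n ℕ.+ k) C (2 ℕ.* k)) ℕ.* sq ((2 ℕ.* k) C k)))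
  - sumℤ n (λ j → (-3ℤ ℤ.^ (n ∸ suc j)) ℤ.* + (((n ℕ.+ suc j ∸ 2) C (2 ℕ.* suc j ∸ 2)) ℕ.* sq ((2 ℕ.* suc j ∸ 2) C j)))

-- Let Tₘ(y) be the number of non-backtracking walks of length m + 1 from y to v, and A the adjacency
-- operator of ℤ². Splitting off the first step, a walk from y is a step to a neighbour y ⊕ d followed by
-- a walk from y ⊕ d that does not step straight back; counting those that do gives the three-term
-- recurrence Tₘ₊₂ = A Tₘ₊₁ - 3 Tₘ. Hence the number of such walks of length ℓ ≥ 2 is
-- ((Q_ℓ - Q_{ℓ-2})(A) δ_v)(v), where Q₀ = 1, Q₁ = x, Qₘ₊₂ = x Qₘ₊₁ - 3 Qₘ, whose coefficients are
-- (-3)ⁱ (m-i choose i) by Pascal's rule. Finally (A^{2k} δ_v)(v) = (2k choose k)², because in the rotated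
-- coordinates x + y, x - y a walk in ℤ² is a pair of independent ±1 walks on ℤ. The two closed forms
-- differ by the reindexing i = n - k.

module Submission where

open import Defs
open import Data.Nat using (ℕ; zero; suc; _∸_; z≤n; s≤s)
import Data.Nat as ℕ
import Data.Nat.Properties as ℕ
import Data.Nat.Tactic.RingSolver as ℕ-Solver
open import Data.Nat.Combinatorics
  using (_C_; k>n⇒nCk≡0; nCk≡nC[n∸k]; nCk+nC[k+1]≡[n+1]C[k+1])
open import Data.Integer using (ℤ; +_; -[1+_])
import Data.Integer.Properties as ℤ
open import Data.Integer.Tactic.RingSolver using (solve-∀)
open import Algebra.Properties.AbelianGroup ℤ.+-0-abelianGroup using () renaming (∙-cancelˡ to +-cancelˡ)
open import Data.Bool using (Bool; true; false; if_then_else_)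
open import Data.Bool.Properties using (¬-not)
open import Data.Empty using (⊥-elim)
open import Data.Unit using (⊤; tt)
open import Data.Product using (Σ; ∃; _×_; _,_; proj₁; proj₂; map₂)
open import Data.Product.Properties using (,-injective; ≡-dec)
open import Data.Sum using (inj₁; inj₂)
open import Data.Fin using (Fin; zero; suc; fromℕ; inject₁; toℕ)
open import Data.Vec using (Vec; []; _∷_; lookup)
open import Data.Vec.Properties using (∷-injectiveʳ)
open import Data.List using (List; []; _∷_; _++_; map; length; foldr; applyUpTo)
open import Data.List.Properties using (length-++; length-map)
open import Data.List.Membership.Propositional using (_∈_)
open import Data.List.Membership.Propositional.Properties using (∈-++⁺ˡ; ∈-++⁺ʳ; ∈-++⁻; ∈-map⁺; ∈-map⁻)
open import Data.List.Relation.Unary.Any using (here)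
open import Data.List.Relation.Unary.AllPairs using ([]; _∷_)
open import Data.List.Relation.Unary.All using ([])
open import Data.List.Relation.Unary.Unique.Propositional using (Unique)
import Data.List.Relation.Unary.Unique.Propositional.Properties as Unique
open import Function.Bundles using (_⇔_; mk⇔; Equivalence)
open import Relation.Binary.Definitions using (DecidableEquality)
open import Relation.Binary.PropositionalEquality
open import Relation.Nullary using (¬_; Dec; yes; no)

-- Integer arithmetic is opened unqualified only inside this module, so that 2 * n in lemma9 stays ℕ's.
module NonBacktracking where

  open import Data.Integer using (_+_; _-_; _*_; -_; _^_)

  -- Steps in ℤ²

  data Dir : Set where
    east west north south : Dir

  dx dy : Dir → ℤ
  dx east  = + 1
  dx west  = -[1+ 0 ]
  dx north = + 0
  dx south = + 0
  dy east  = + 0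
  dy west  = + 0
  dy north = + 1
  dy south = -[1+ 0 ]

  infixl 6 _⊕_
  _⊕_ : V → Dir → V
  (a , b) ⊕ d = (a + dx d , b + dy d)

  opposite : Dir → Dir
  opposite east  = west
  opposite west  = east
  opposite north = south
  opposite south = north

  opposite-involutive : ∀ d → opposite (opposite d) ≡ d
  opposite-involutive east  = refl
  opposite-involutive west  = refl
  opposite-involutive north = refl
  opposite-involutive south = refl

  isOpposite : Dir → Dir → Bool
  isOpposite east  west  = true
  isOpposite west  east  = true
  isOpposite north south = true
  isOpposite south north = true
  isOpposite _     _     = false

  isOpposite-opposite : ∀ d → isOpposite d (opposite d) ≡ true
  isOpposite-opposite east  = refl
  isOpposite-opposite west  = refl
  isOpposite-opposite north = refl
  isOpposite-opposite south = refl

  isOpposite⇒≡opposite : ∀ d d′ → isOpposite d d′ ≡ true → d′ ≡ opposite d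
  isOpposite⇒≡opposite east  west  _ = refl
  isOpposite⇒≡opposite west  east  _ = refl
  isOpposite⇒≡opposite north south _ = refl
  isOpposite⇒≡opposite south north _ = refl
  isOpposite⇒≡opposite east  east  ()
  isOpposite⇒≡opposite east  north ()
  isOpposite⇒≡opposite east  south ()
  isOpposite⇒≡opposite west  west  ()
  isOpposite⇒≡opposite west  north ()
  isOpposite⇒≡opposite west  south ()
  isOpposite⇒≡opposite north east  ()
  isOpposite⇒≡opposite north west  ()
  isOpposite⇒≡opposite north north ()
  isOpposite⇒≡opposite south east  ()
  isOpposite⇒≡opposite south west  ()
  isOpposite⇒≡opposite south south ()

  dx-dy-injective : ∀ d d′ → dx d ≡ dx d′ → dy d ≡ dy d′ → d ≡ d′
  dx-dy-injective east  east  _ _ = refl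
  dx-dy-injective west  west  _ _ = refl
  dx-dy-injective north north _ _ = refl
  dx-dy-injective south south _ _ = refl
  dx-dy-injective east  west  () _
  dx-dy-injective east  north () _
  dx-dy-injective east  south () _
  dx-dy-injective west  east  () _
  dx-dy-injective west  north () _
  dx-dy-injective west  south () _
  dx-dy-injective north east  () _
  dx-dy-injective north west  () _
  dx-dy-injective north south _ ()
  dx-dy-injective south east  () _
  dx-dy-injective south west  () _
  dx-dy-injective south north _ ()

  ⊕-injectiveʳ : ∀ z {d d′} → z ⊕ d ≡ z ⊕ d′ → d ≡ d′
  ⊕-injectiveʳ (a , b) {d} {d′} eq with ,-injective eq
  ... | eqx , eqy = dx-dy-injective d d′ (+-cancelˡ a _ _ eqx) (+-cancelˡ b _ _ eqy)

  ⊕-opposite : ∀ z d → z ⊕ d ⊕ opposite d ≡ z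
  ⊕-opposite (a , b) d =
    cong₂ _,_ (trans (ℤ.+-assoc a _ _) (trans (cong (λ t → a + t) (dx-cancel d)) (ℤ.+-identityʳ a)))
              (trans (ℤ.+-assoc b _ _) (trans (cong (λ t → b + t) (dy-cancel d)) (ℤ.+-identityʳ b)))
    where
    dx-cancel : ∀ d → dx d + dx (opposite d) ≡ + 0
    dx-cancel east  = refl
    dx-cancel west  = refl
    dx-cancel north = refl
    dx-cancel south = refl
    dy-cancel : ∀ d → dy d + dy (opposite d) ≡ + 0
    dy-cancel east  = refl
    dy-cancel west  = refl
    dy-cancel north = refl
    dy-cancel south = refl

  ⊕-⊕≢-unless-isOpposite : ∀ z d d′ → isOpposite d d′ ≡ false → z ⊕ d ⊕ d′ ≢ z
  ⊕-⊕≢-unless-isOpposite z d d′ not-opposite returns =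
    true≢false (trans (sym (isOpposite-opposite d)) (subst (λ e → isOpposite d e ≡ false) d′≡ not-opposite))
    where
    d′≡ : d′ ≡ opposite d
    d′≡ = ⊕-injectiveʳ (z ⊕ d) {d′} {opposite d} (trans returns (sym (⊕-opposite z d)))
    true≢false : true ≢ false
    true≢false ()

  Adj-⊕ : ∀ z d → Adj z (z ⊕ d)
  Adj-⊕ (a , b) d = trans (squares a b (dx d) (dy d)) (unit d)
    where
    squares : ∀ a b x y →
      (a - (a + x)) * (a - (a + x)) + (b - (b + y)) * (b - (b + y)) ≡ x * x + y * y
    squares = solve-∀
    unit : ∀ d → dx d * dx d + dy d * dy d ≡ + 1
    unit east  = refl
    unit west  = refl
    unit north = refl
    unit south = refl

  unit-vector : ∀ x y → x * x + y * y ≡ + 1 → ∃ λ d → dx d ≡ x × dy d ≡ y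
  unit-vector (+ 1)        (+ 0)          _ = east  , refl , refl
  unit-vector -[1+ 0 ]     (+ 0)          _ = west  , refl , refl
  unit-vector (+ 0)        (+ 1)          _ = north , refl , refl
  unit-vector (+ 0)        -[1+ 0 ]       _ = south , refl , refl
  unit-vector (+ 0)        (+ 0)          ()
  unit-vector (+ 0)        (+ suc (suc _)) ()
  unit-vector (+ 0)        -[1+ suc _ ]   ()
  unit-vector (+ 1)        (+ suc _)      ()
  unit-vector (+ 1)        -[1+ _ ]       ()
  unit-vector -[1+ 0 ]     (+ suc _)      ()
  unit-vector -[1+ 0 ]     -[1+ _ ]       ()
  unit-vector (+ suc (suc _)) (+ 0)       ()
  unit-vector (+ suc (suc _)) (+ suc _)   ()
  unit-vector (+ suc (suc _)) -[1+ _ ]    ()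
  unit-vector -[1+ suc _ ] (+ 0)          ()
  unit-vector -[1+ suc _ ] (+ suc _)      ()
  unit-vector -[1+ suc _ ] -[1+ _ ]       ()

  Adj⇒⊕ : ∀ p q → Adj p q → ∃ λ d → q ≡ p ⊕ d
  Adj⇒⊕ (a , b) (c , e) adj = displacement (unit-vector (c - a) (e - b) (trans (flip a b c e) adj))
    where
    flip : ∀ a b c e → (c - a) * (c - a) + (e - b) * (e - b) ≡ (a - c) * (a - c) + (b - e) * (b - e)
    flip = solve-∀
    shift : ∀ a c → c ≡ a + (c - a)
    shift = solve-∀
    displacement : (∃ λ d → dx d ≡ c - a × dy d ≡ e - b) → ∃ λ d → (c , e) ≡ (a , b) ⊕ d
    displacement (d , dx≡ , dy≡) =
      d , cong₂ _,_ (trans (shift a c) (cong (λ t → a + t) (sym dx≡)))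
                    (trans (shift b e) (cong (λ t → b + t) (sym dy≡)))

  ∑ᵈ : (Dir → ℕ) → ℕ
  ∑ᵈ f = f east ℕ.+ (f west ℕ.+ (f north ℕ.+ f south))

  ∑ᵈ-cong : ∀ {f g : Dir → ℕ} → (∀ d → f d ≡ g d) → ∑ᵈ f ≡ ∑ᵈ g
  ∑ᵈ-cong f≡g = cong₂ ℕ._+_ (f≡g east) (cong₂ ℕ._+_ (f≡g west) (cong₂ ℕ._+_ (f≡g north) (f≡g south)))

  ⋃ᵈ : ∀ {X : Set} → (Dir → List X) → List X
  ⋃ᵈ f = f east ++ (f west ++ (f north ++ f south))

  module _ {X : Set} (f : Dir → List X) where

    ∈-⋃ᵈ⁻ : ∀ {x} → x ∈ ⋃ᵈ f → ∃ λ d → x ∈ f d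
    ∈-⋃ᵈ⁻ x∈ with ∈-++⁻ (f east) x∈
    ... | inj₁ x∈ = east , x∈
    ... | inj₂ x∈ with ∈-++⁻ (f west) x∈
    ... | inj₁ x∈ = west , x∈
    ... | inj₂ x∈ with ∈-++⁻ (f north) x∈
    ... | inj₁ x∈ = north , x∈
    ... | inj₂ x∈ = south , x∈

    ∈-⋃ᵈ⁺ : ∀ {x} d → x ∈ f d → x ∈ ⋃ᵈ f
    ∈-⋃ᵈ⁺ east  x∈ = ∈-++⁺ˡ x∈
    ∈-⋃ᵈ⁺ west  x∈ = ∈-++⁺ʳ (f east) (∈-++⁺ˡ x∈)
    ∈-⋃ᵈ⁺ north x∈ = ∈-++⁺ʳ (f east) (∈-++⁺ʳ (f west) (∈-++⁺ˡ x∈))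
    ∈-⋃ᵈ⁺ south x∈ = ∈-++⁺ʳ (f east) (∈-++⁺ʳ (f west) (∈-++⁺ʳ (f north) x∈))

    length-⋃ᵈ : length (⋃ᵈ f) ≡ ∑ᵈ (λ d → length (f d))
    length-⋃ᵈ = trans (length-++ (f east)) (cong (length (f east) ℕ.+_)
                  (trans (length-++ (f west)) (cong (length (f west) ℕ.+_) (length-++ (f north)))))

    ⋃ᵈ-unique : (∀ d → Unique (f d)) → (∀ {d d′ x} → x ∈ f d → x ∈ f d′ → d ≡ d′) → Unique (⋃ᵈ f)
    ⋃ᵈ-unique unique disjoint =
      Unique.++⁺ (unique east)
        (Unique.++⁺ (unique west)
          (Unique.++⁺ (unique north) (unique south) (apart (λ ())))
          (apart₂ (λ ()) (λ ())))
        (apart₃ (λ ()) (λ ()) (λ ()))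
      where
      apart : ∀ {a b x} → a ≢ b → ¬ (x ∈ f a × x ∈ f b)
      apart a≢b (x∈a , x∈b) = a≢b (disjoint x∈a x∈b)
      apart₂ : ∀ {a b c x} → a ≢ b → a ≢ c → ¬ (x ∈ f a × x ∈ f b ++ f c)
      apart₂ {b = b} a≢b a≢c (x∈a , x∈bc) with ∈-++⁻ (f b) x∈bc
      ... | inj₁ x∈b = apart a≢b (x∈a , x∈b)
      ... | inj₂ x∈c = apart a≢c (x∈a , x∈c)
      apart₃ : ∀ {a b c e x} → a ≢ b → a ≢ c → a ≢ e → ¬ (x ∈ f a × x ∈ f b ++ (f c ++ f e))
      apart₃ {b = b} a≢b a≢c a≢e (x∈a , x∈bce) with ∈-++⁻ (f b) x∈bce
      ... | inj₁ x∈b = apart a≢b (x∈a , x∈b)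
      ... | inj₂ x∈ce = apart₂ a≢c a≢e (x∈a , x∈ce)

  -- Enumerating non-backtracking walks

  infix 4 _≟V_
  _≟V_ : DecidableEquality V
  _≟V_ = ≡-dec ℤ._≟_ ℤ._≟_

  indicator : ∀ {P : Set} → Dec P → ℕ
  indicator (yes _) = 1
  indicator (no _)  = 0

  IsWalk : ∀ {n} → Vec V (suc n) → Set
  IsWalk (a ∷ [])    = ⊤
  IsWalk (a ∷ b ∷ w) = Adj a b × IsWalk (b ∷ w)

  IsNonBacktracking : ∀ {n} → Vec V n → Set
  IsNonBacktracking (a ∷ b ∷ c ∷ w) = c ≢ a × IsNonBacktracking (b ∷ c ∷ w)
  IsNonBacktracking _               = ⊤

  IsWalk⇔Adj-lookup : ∀ {n} (w : Vec V (suc n)) →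
    IsWalk w ⇔ ((i : Fin n) → Adj (lookup w (inject₁ i)) (lookup w (suc i)))
  IsWalk⇔Adj-lookup w = mk⇔ (to w) (from w)
    where
    to : ∀ {n} (w : Vec V (suc n)) → IsWalk w → (i : Fin n) → Adj (lookup w (inject₁ i)) (lookup w (suc i))
    to (a ∷ b ∷ w) (adj , _)    zero    = adj
    to (a ∷ b ∷ w) (_ , steps) (suc i) = to (b ∷ w) steps i
    from : ∀ {n} (w : Vec V (suc n)) → ((i : Fin n) → Adj (lookup w (inject₁ i)) (lookup w (suc i))) → IsWalk w
    from (a ∷ [])    _   = tt
    from (a ∷ b ∷ w) adj = adj zero , from (b ∷ w) (λ i → adj (suc i))

  IsNonBacktracking⇔lookup : ∀ {n} (w : Vec V n) →
    IsNonBacktracking w ⇔ ((j k : Fin n) → toℕ j ≡ 2 ℕ.+ toℕ k → lookup w j ≢ lookup w k)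
  IsNonBacktracking⇔lookup w = mk⇔ (to w) (from w)
    where
    to : ∀ {n} (w : Vec V n) → IsNonBacktracking w →
         (j k : Fin n) → toℕ j ≡ 2 ℕ.+ toℕ k → lookup w j ≢ lookup w k
    to (a ∷ b ∷ c ∷ w) (c≢a , _)  (suc (suc zero)) zero    refl = c≢a
    to (a ∷ b ∷ c ∷ w) (_ , rest) (suc j)          (suc k) j≡  = to (b ∷ c ∷ w) rest j k (ℕ.suc-injective j≡)
    to (a ∷ [])        _ zero    _ ()
    to (a ∷ b ∷ [])    _ zero    _ ()
    to (a ∷ b ∷ [])    _ (suc zero) _ ()
    to (a ∷ b ∷ c ∷ w) _ zero    _ ()
    to (a ∷ b ∷ c ∷ w) _ (suc zero) _ ()
    to (a ∷ b ∷ c ∷ w) _ (suc (suc (suc _))) zero ()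
    from : ∀ {n} (w : Vec V n) → ((j k : Fin n) → toℕ j ≡ 2 ℕ.+ toℕ k → lookup w j ≢ lookup w k) →
           IsNonBacktracking w
    from []              _  = tt
    from (a ∷ [])        _  = tt
    from (a ∷ b ∷ [])    _  = tt
    from (a ∷ b ∷ c ∷ w) nb =
      nb (suc (suc zero)) zero refl , from (b ∷ c ∷ w) (λ j k j≡ → nb (suc j) (suc k) (cong suc j≡))

  module Enumeration (v : V) where

    -- The non-backtracking walks y, y ⊕ d, … of length m + 1 that end at v.
    nbWalks : (m : ℕ) → V → Dir → List (Vec V (suc (suc m)))
    continuations : (m : ℕ) → V → Dir → Dir → List (Vec V (suc (suc m)))

    nbWalks zero    y d with y ⊕ d ≟V v
    ... | yes _ = (y ∷ y ⊕ d ∷ []) ∷ []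
    ... | no _  = []
    nbWalks (suc m) y d = map (y ∷_) (⋃ᵈ (continuations m y d))

    continuations m y d d′ = if isOpposite d d′ then [] else nbWalks m (y ⊕ d) d′

    nbCount : ℕ → V → Dir → ℕ
    nbCount zero    y d = indicator (y ⊕ d ≟V v)
    nbCount (suc m) y d = ∑ᵈ λ d′ → if isOpposite d d′ then 0 else nbCount m (y ⊕ d) d′

    length-nbWalks : ∀ m y d → length (nbWalks m y d) ≡ nbCount m y d
    length-nbWalks zero y d with y ⊕ d ≟V v
    ... | yes _ = refl
    ... | no _  = refl
    length-nbWalks (suc m) y d = begin
      length (map (y ∷_) (⋃ᵈ (continuations m y d)))  ≡⟨ length-map (y ∷_) (⋃ᵈ (continuations m y d)) ⟩
      length (⋃ᵈ (continuations m y d))               ≡⟨ length-⋃ᵈ (continuations m y d) ⟩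
      ∑ᵈ (λ d′ → length (continuations m y d d′))     ≡⟨ ∑ᵈ-cong length-continuations ⟩
      nbCount (suc m) y d                              ∎
      where
      open ≡-Reasoning
      length-continuations : ∀ d′ →
        length (continuations m y d d′) ≡ (if isOpposite d d′ then 0 else nbCount m (y ⊕ d) d′)
      length-continuations d′ with isOpposite d d′
      ... | true  = refl
      ... | false = length-nbWalks m (y ⊕ d) d′

    NBPath : ∀ m → Dir → Vec V (suc (suc m)) → Set
    NBPath zero    d (a ∷ b ∷ [])    = b ≡ a ⊕ d × b ≡ v
    NBPath (suc m) d (a ∷ b ∷ c ∷ w) =
      b ≡ a ⊕ d × ∃ λ d′ → isOpposite d d′ ≡ false × NBPath m d′ (b ∷ c ∷ w)

    NBPath-first-step : ∀ m d a b (w : Vec V m) → NBPath m d (a ∷ b ∷ w) → b ≡ a ⊕ d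
    NBPath-first-step zero    d a b []      (b≡ , _) = b≡
    NBPath-first-step (suc m) d a b (c ∷ w) (b≡ , _) = b≡

    ∈-nbWalks⇔ : ∀ m y d (w : Vec V (suc (suc m))) →
      w ∈ nbWalks m y d ⇔ (lookup w zero ≡ y × NBPath m d w)
    ∈-nbWalks⇔ m y d w = mk⇔ (to m y d w) (from m y d w)
      where
      to : ∀ m y d (w : Vec V (suc (suc m))) → w ∈ nbWalks m y d → lookup w zero ≡ y × NBPath m d w
      to zero y d w w∈ with y ⊕ d ≟V v
      to zero y d _ (here refl) | yes y⊕d≡v = refl , refl , y⊕d≡v
      to (suc m) y d w w∈ with ∈-map⁻ (y ∷_) w∈
      ... | b ∷ c ∷ w′ , w′∈ , refl with ∈-⋃ᵈ⁻ (continuations m y d) w′∈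
      ... | d′ , w′∈′ with isOpposite d d′ in not-opposite
      ... | false with to m (y ⊕ d) d′ (b ∷ c ∷ w′) w′∈′
      ... | b≡ , path = refl , b≡ , d′ , not-opposite , path
      from : ∀ m y d (w : Vec V (suc (suc m))) → lookup w zero ≡ y × NBPath m d w → w ∈ nbWalks m y d
      from zero y d (a ∷ b ∷ []) (refl , refl , b≡v) with y ⊕ d ≟V v
      ... | yes _    = here refl
      ... | no b≢v   = ⊥-elim (b≢v b≡v)
      from (suc m) y d (a ∷ b ∷ c ∷ w) (refl , refl , d′ , not-opposite , path) =
        ∈-map⁺ (y ∷_) (∈-⋃ᵈ⁺ (continuations m a d) d′
          (subst (λ o → b ∷ c ∷ w ∈ (if o then [] else nbWalks m b d′)) (sym not-opposite)
                 (from m b d′ (b ∷ c ∷ w) (refl , path))))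

    ∈-nbWalks⇒second-vertex : ∀ m y d (w : Vec V (suc (suc m))) → w ∈ nbWalks m y d → lookup w (suc zero) ≡ y ⊕ d
    ∈-nbWalks⇒second-vertex m y d (a ∷ b ∷ w) w∈ with Equivalence.to (∈-nbWalks⇔ m y d (a ∷ b ∷ w)) w∈
    ... | refl , path = NBPath-first-step m d a b w path

    nbWalks-unique : ∀ m y d → Unique (nbWalks m y d)
    nbWalks-unique zero y d with y ⊕ d ≟V v
    ... | yes _ = [] ∷ []
    ... | no _  = []
    nbWalks-unique (suc m) y d =
      Unique.map⁺ ∷-injectiveʳ (⋃ᵈ-unique (continuations m y d) continuations-unique disjoint)
      where
      ∈-continuations : ∀ {d′ w} → w ∈ continuations m y d d′ → w ∈ nbWalks m (y ⊕ d) d′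
      ∈-continuations {d′} w∈ with isOpposite d d′
      ... | false = w∈
      continuations-unique : ∀ d′ → Unique (continuations m y d d′)
      continuations-unique d′ with isOpposite d d′
      ... | true  = []
      ... | false = nbWalks-unique m (y ⊕ d) d′
      disjoint : ∀ {d′ d″ w} → w ∈ continuations m y d d′ → w ∈ continuations m y d d″ → d′ ≡ d″
      disjoint {d′} {d″} {w} w∈′ w∈″ =
        ⊕-injectiveʳ (y ⊕ d) {d′} {d″}
          (trans (sym (∈-nbWalks⇒second-vertex m (y ⊕ d) d′ w (∈-continuations w∈′)))
                 (∈-nbWalks⇒second-vertex m (y ⊕ d) d″ w (∈-continuations w∈″)))

    NBPath⇒IsWalk : ∀ m d (w : Vec V (suc (suc m))) → NBPath m d w → IsWalk w
    NBPath⇒IsWalk zero    d (a ∷ b ∷ [])    (refl , _) = Adj-⊕ a d , tt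
    NBPath⇒IsWalk (suc m) d (a ∷ b ∷ c ∷ w) (refl , d′ , _ , path) =
      Adj-⊕ a d , NBPath⇒IsWalk m d′ (b ∷ c ∷ w) path

    NBPath⇒IsNonBacktracking : ∀ m d (w : Vec V (suc (suc m))) → NBPath m d w → IsNonBacktracking w
    NBPath⇒IsNonBacktracking zero    d (a ∷ b ∷ [])    _ = tt
    NBPath⇒IsNonBacktracking (suc m) d (a ∷ b ∷ c ∷ w) (refl , d′ , not-opposite , path) =
      c≢a , NBPath⇒IsNonBacktracking m d′ (b ∷ c ∷ w) path
      where
      c≢a : c ≢ a
      c≢a c≡a = ⊕-⊕≢-unless-isOpposite a d d′ not-opposite
                  (trans (sym (NBPath-first-step m d′ (a ⊕ d) c w path)) c≡a)

    NBPath⇒last : ∀ m d (w : Vec V (suc (suc m))) → NBPath m d w → lookup w (fromℕ (suc m)) ≡ v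
    NBPath⇒last zero    d (a ∷ b ∷ [])    (_ , b≡v)          = b≡v
    NBPath⇒last (suc m) d (a ∷ b ∷ c ∷ w) (_ , d′ , _ , path) = NBPath⇒last m d′ (b ∷ c ∷ w) path

    IsNonBacktrackingWalk⇒NBPath : ∀ m (w : Vec V (suc (suc m))) →
      IsWalk w → IsNonBacktracking w → lookup w (fromℕ (suc m)) ≡ v → ∃ λ d → NBPath m d w
    IsNonBacktrackingWalk⇒NBPath zero (a ∷ b ∷ []) (adj , _) _ b≡v =
      map₂ (_, b≡v) (Adj⇒⊕ a b adj)
    IsNonBacktrackingWalk⇒NBPath (suc m) (a ∷ b ∷ c ∷ w) (adj , walk) (c≢a , nb) last =
      extend (Adj⇒⊕ a b adj) (IsNonBacktrackingWalk⇒NBPath m (b ∷ c ∷ w) walk nb last)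
      where
      extend : (∃ λ d → b ≡ a ⊕ d) → (∃ λ d′ → NBPath m d′ (b ∷ c ∷ w)) →
               ∃ λ d → NBPath (suc m) d (a ∷ b ∷ c ∷ w)
      extend (d , b≡) (d′ , path) = d , b≡ , d′ , ¬-not not-opposite , path
        where
        not-opposite : isOpposite d d′ ≢ true
        not-opposite is-opposite = c≢a (begin
          c                    ≡⟨ NBPath-first-step m d′ b c w path ⟩
          b ⊕ d′               ≡⟨ cong₂ _⊕_ b≡ (isOpposite⇒≡opposite d d′ is-opposite) ⟩
          a ⊕ d ⊕ opposite d   ≡⟨ ⊕-opposite a d ⟩
          a                    ∎)
          where open ≡-Reasoning

    closedNBWalks : ∀ m → List (Vec V (suc (suc m)))
    closedNBWalks m = ⋃ᵈ (nbWalks m v)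

    ∈-closedNBWalks⇔ : ∀ m (w : Vec V (suc (suc m))) → w ∈ closedNBWalks m ⇔ ClosedNBWalk v (suc m) w
    ∈-closedNBWalks⇔ m w = mk⇔ to from
      where
      to : w ∈ closedNBWalks m → ClosedNBWalk v (suc m) w
      to w∈ with ∈-⋃ᵈ⁻ (nbWalks m v) w∈
      ... | d , w∈d with Equivalence.to (∈-nbWalks⇔ m v d w) w∈d
      ... | first , path =
        first , NBPath⇒last m d w path ,
        Equivalence.to (IsWalk⇔Adj-lookup w) (NBPath⇒IsWalk m d w path) ,
        Equivalence.to (IsNonBacktracking⇔lookup w) (NBPath⇒IsNonBacktracking m d w path)
      from : ClosedNBWalk v (suc m) w → w ∈ closedNBWalks m
      from (first , last , steps , nb)
        with IsNonBacktrackingWalk⇒NBPath m w (Equivalence.from (IsWalk⇔Adj-lookup w) steps)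
                                              (Equivalence.from (IsNonBacktracking⇔lookup w) nb) last
      ... | d , path = ∈-⋃ᵈ⁺ (nbWalks m v) d (Equivalence.from (∈-nbWalks⇔ m v d w) (first , path))

    closedNBWalks-unique : ∀ m → Unique (closedNBWalks m)
    closedNBWalks-unique m = ⋃ᵈ-unique (nbWalks m v) (nbWalks-unique m v) disjoint
      where
      disjoint : ∀ {d d′ w} → w ∈ nbWalks m v d → w ∈ nbWalks m v d′ → d ≡ d′
      disjoint {d} {d′} {w} w∈ w∈′ =
        ⊕-injectiveʳ v {d} {d′} (trans (sym (∈-nbWalks⇒second-vertex m v d w w∈))
                                       (∈-nbWalks⇒second-vertex m v d′ w w∈′))

    closedNBWalks-count : ∀ m → HasCount (ClosedNBWalk v (suc m)) (∑ᵈ (nbCount m v))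
    closedNBWalks-count m =
      closedNBWalks m , closedNBWalks-unique m , ∈-closedNBWalks⇔ m ,
      trans (length-⋃ᵈ (nbWalks m v)) (∑ᵈ-cong (length-nbWalks m v))

    emptyWalk-count : HasCount (ClosedNBWalk v 0) 1
    emptyWalk-count = (v ∷ []) ∷ [] , [] ∷ [] , ∈-singleton⇔ , refl
      where
      ∈-singleton⇔ : ∀ w → w ∈ (v ∷ []) ∷ [] ⇔ ClosedNBWalk v 0 w
      ∈-singleton⇔ (a ∷ []) = mk⇔ (λ { (here refl) → refl , refl , (λ ()) , λ { zero _ () } })
                                  (λ (a≡v , _) → here (cong (_∷ []) a≡v))

  -- The three-term recurrence

  ∑ᵈℤ : (Dir → ℤ) → ℤ
  ∑ᵈℤ f = f east + (f west + (f north + f south))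

  ∑ᵈℤ-cong : ∀ {f g : Dir → ℤ} → (∀ d → f d ≡ g d) → ∑ᵈℤ f ≡ ∑ᵈℤ g
  ∑ᵈℤ-cong f≡g = cong₂ _+_ (f≡g east) (cong₂ _+_ (f≡g west) (cong₂ _+_ (f≡g north) (f≡g south)))

  ∑ᵈ-skip : ∀ (f : Dir → ℕ) d →
    + ∑ᵈ (λ d′ → if isOpposite d d′ then 0 else f d′) ≡ + ∑ᵈ f - + f (opposite d)
  ∑ᵈ-skip f east  = skip-2nd (+ f east) (+ f west) (+ f north) (+ f south)
    where
    skip-2nd : ∀ a b c e → a + (+ 0 + (c + e)) ≡ a + (b + (c + e)) - b
    skip-2nd = solve-∀
  ∑ᵈ-skip f west  = skip-1st (+ f east) (+ f west) (+ f north) (+ f south)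
    where
    skip-1st : ∀ a b c e → + 0 + (b + (c + e)) ≡ a + (b + (c + e)) - a
    skip-1st = solve-∀
  ∑ᵈ-skip f north = skip-4th (+ f east) (+ f west) (+ f north) (+ f south)
    where
    skip-4th : ∀ a b c e → a + (b + (c + + 0)) ≡ a + (b + (c + e)) - e
    skip-4th = solve-∀
  ∑ᵈ-skip f south = skip-3rd (+ f east) (+ f west) (+ f north) (+ f south)
    where
    skip-3rd : ∀ a b c e → a + (b + (+ 0 + e)) ≡ a + (b + (c + e)) - c
    skip-3rd = solve-∀

  adjacency : (V → ℤ) → V → ℤ
  adjacency f y = ∑ᵈℤ (λ d → f (y ⊕ d))

  adjacency-cong : ∀ {f g : V → ℤ} → (∀ y → f y ≡ g y) → ∀ y → adjacency f y ≡ adjacency g y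
  adjacency-cong f≡g y = ∑ᵈℤ-cong (λ d → f≡g (y ⊕ d))

  adjacency-sub : ∀ (f g : V → ℤ) y → adjacency (λ z → f z - g z) y ≡ adjacency f y - adjacency g y
  adjacency-sub f g y = distrib (f (y ⊕ east)) (f (y ⊕ west)) (f (y ⊕ north)) (f (y ⊕ south))
                              (g (y ⊕ east)) (g (y ⊕ west)) (g (y ⊕ north)) (g (y ⊕ south))
    where
    distrib : ∀ a₁ a₂ a₃ a₄ b₁ b₂ b₃ b₄ →
      (a₁ - b₁) + ((a₂ - b₂) + ((a₃ - b₃) + (a₄ - b₄)))
      ≡ (a₁ + (a₂ + (a₃ + a₄))) - (b₁ + (b₂ + (b₃ + b₄)))
    distrib = solve-∀

  ChebyshevRecurrence : (ℕ → V → ℤ) → Set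
  ChebyshevRecurrence f = ∀ m y → f (suc (suc m)) y ≡ adjacency (f (suc m)) y - + 3 * f m y

  ChebyshevRecurrence-unique : ∀ {f g} → ChebyshevRecurrence f → ChebyshevRecurrence g →
    (∀ y → f 0 y ≡ g 0 y) → (∀ y → f 1 y ≡ g 1 y) → ∀ m y → f m y ≡ g m y
  ChebyshevRecurrence-unique {f} {g} f-rec g-rec f0≡g0 f1≡g1 m = proj₁ (consecutive m)
    where
    consecutive : ∀ m → (∀ y → f m y ≡ g m y) × (∀ y → f (suc m) y ≡ g (suc m) y)
    consecutive zero    = f0≡g0 , f1≡g1
    consecutive (suc m) with consecutive m
    ... | fm≡gm , fm+1≡gm+1 = fm+1≡gm+1 , λ y →
      trans (f-rec m y)
            (trans (cong₂ (λ a b → a - + 3 * b) (adjacency-cong fm+1≡gm+1 y) (fm≡gm y)) (sym (g-rec m y)))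

  module Counting (v : V) where

    open Enumeration v

    δ : V → ℤ
    δ y = + indicator (y ≟V v)

    -- nbTotal m y = Tₘ(y) counts the non-backtracking walks of length m + 1 from y to v.
    nbTotal : ℕ → V → ℤ
    nbTotal m y = ∑ᵈℤ (λ d → + nbCount m y d)

    -- A walk from y ⊕ d whose first step goes back to y is that step followed by a walk from y whose
    -- first step is not d.
    nbCount-back : ∀ m y d → + nbCount (suc m) (y ⊕ d) (opposite d) ≡ nbTotal m y - + nbCount m y d
    nbCount-back m y d = begin
      + nbCount (suc m) (y ⊕ d) (opposite d)
        ≡⟨ cong (λ z → + ∑ᵈ (λ d′ → if isOpposite (opposite d) d′ then 0 else nbCount m z d′))
                (⊕-opposite y d) ⟩
      + ∑ᵈ (λ d′ → if isOpposite (opposite d) d′ then 0 else nbCount m y d′)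
        ≡⟨ ∑ᵈ-skip (nbCount m y) (opposite d) ⟩
      nbTotal m y - + nbCount m y (opposite (opposite d))
        ≡⟨ cong (λ e → nbTotal m y - + nbCount m y e) (opposite-involutive d) ⟩
      nbTotal m y - + nbCount m y d
        ∎
      where open ≡-Reasoning

    nbTotal-1 : ∀ y → nbTotal 1 y ≡ adjacency (adjacency δ) y - + 4 * δ y
    nbTotal-1 y = begin
      nbTotal 1 y
        ≡⟨ ∑ᵈℤ-cong (λ d → ∑ᵈ-skip (nbCount 0 (y ⊕ d)) d) ⟩
      ∑ᵈℤ (λ d → adjacency δ (y ⊕ d) - δ (y ⊕ d ⊕ opposite d))
        ≡⟨ ∑ᵈℤ-cong (λ d → cong (λ z → adjacency δ (y ⊕ d) - δ z) (⊕-opposite y d)) ⟩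
      ∑ᵈℤ (λ d → adjacency δ (y ⊕ d) - δ y)
        ≡⟨ minus-const (adjacency δ (y ⊕ east)) (adjacency δ (y ⊕ west))
                       (adjacency δ (y ⊕ north)) (adjacency δ (y ⊕ south)) (δ y) ⟩
      adjacency (adjacency δ) y - + 4 * δ y
        ∎
      where
      open ≡-Reasoning
      minus-const : ∀ a₁ a₂ a₃ a₄ t →
        (a₁ - t) + ((a₂ - t) + ((a₃ - t) + (a₄ - t))) ≡ (a₁ + (a₂ + (a₃ + a₄))) - + 4 * t
      minus-const = solve-∀

    -- Prefixing the step y → y ⊕ d to a walk from y ⊕ d backtracks exactly when that walk starts by
    -- stepping back to y; by nbCount-back these exceptions add up to 4 Tₘ(y) - Tₘ(y).
    nbTotal-recurrence : ∀ m y → nbTotal (suc (suc m)) y ≡ adjacency (nbTotal (suc m)) y - + 3 * nbTotal m y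
    nbTotal-recurrence m y = begin
      nbTotal (suc (suc m)) y
        ≡⟨ ∑ᵈℤ-cong (λ d → ∑ᵈ-skip (nbCount (suc m) (y ⊕ d)) d) ⟩
      ∑ᵈℤ (λ d → nbTotal (suc m) (y ⊕ d) - + nbCount (suc m) (y ⊕ d) (opposite d))
        ≡⟨ ∑ᵈℤ-cong (λ d → cong (λ t → nbTotal (suc m) (y ⊕ d) - t) (nbCount-back m y d)) ⟩
      ∑ᵈℤ (λ d → nbTotal (suc m) (y ⊕ d) - (nbTotal m y - + nbCount m y d))
        ≡⟨ regroup (nbTotal (suc m) (y ⊕ east)) (nbTotal (suc m) (y ⊕ west))
                   (nbTotal (suc m) (y ⊕ north)) (nbTotal (suc m) (y ⊕ south))
                   (+ nbCount m y east) (+ nbCount m y west) (+ nbCount m y north) (+ nbCount m y south) ⟩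
      adjacency (nbTotal (suc m)) y - + 3 * nbTotal m y
        ∎
      where
      open ≡-Reasoning
      regroup : ∀ a₁ a₂ a₃ a₄ b₁ b₂ b₃ b₄ → let t = b₁ + (b₂ + (b₃ + b₄)) in
        (a₁ - (t - b₁)) + ((a₂ - (t - b₂)) + ((a₃ - (t - b₃)) + (a₄ - (t - b₄))))
        ≡ (a₁ + (a₂ + (a₃ + a₄))) - + 3 * t
      regroup = solve-∀

    module _ (Q : ℕ → V → ℤ) (Q-rec : ChebyshevRecurrence Q)
             (Q-0 : ∀ y → Q 0 y ≡ δ y) (Q-1 : ∀ y → Q 1 y ≡ adjacency δ y) where

      private
        gap : ℕ → V → ℤ
        gap m y = Q (suc (suc m)) y - Q m y

        gap-ChebyshevRecurrence : ChebyshevRecurrence gap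
        gap-ChebyshevRecurrence m y = begin
          Q (4 ℕ.+ m) y - Q (2 ℕ.+ m) y
            ≡⟨ cong₂ _-_ (Q-rec (2 ℕ.+ m) y) (Q-rec m y) ⟩
          (adjacency (Q (3 ℕ.+ m)) y - + 3 * Q (2 ℕ.+ m) y) - (adjacency (Q (suc m)) y - + 3 * Q m y)
            ≡⟨ regroup (adjacency (Q (3 ℕ.+ m)) y) (adjacency (Q (suc m)) y) (Q (2 ℕ.+ m) y) (Q m y) ⟩
          (adjacency (Q (3 ℕ.+ m)) y - adjacency (Q (suc m)) y) - + 3 * gap m y
            ≡⟨ cong (λ t → t - + 3 * gap m y) (adjacency-sub (Q (3 ℕ.+ m)) (Q (suc m)) y) ⟨
          adjacency (gap (suc m)) y - + 3 * gap m y
            ∎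
          where
          open ≡-Reasoning
          regroup : ∀ a b c e → (a - + 3 * c) - (b - + 3 * e) ≡ (a - b) - + 3 * (c - e)
          regroup = solve-∀

        gap-0 : ∀ y → gap 0 y ≡ adjacency (adjacency δ) y - + 4 * δ y
        gap-0 y = begin
          Q 2 y - Q 0 y
            ≡⟨ cong₂ _-_ (Q-rec 0 y) (Q-0 y) ⟩
          adjacency (Q 1) y - + 3 * Q 0 y - δ y
            ≡⟨ cong₂ (λ a b → a - + 3 * b - δ y) (adjacency-cong Q-1 y) (Q-0 y) ⟩
          adjacency (adjacency δ) y - + 3 * δ y - δ y
            ≡⟨ regroup (adjacency (adjacency δ) y) (δ y) ⟩
          adjacency (adjacency δ) y - + 4 * δ y
            ∎
          where
          open ≡-Reasoning
          regroup : ∀ a b → a - + 3 * b - b ≡ a - + 4 * b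
          regroup = solve-∀

        nbTotal-1≡gap-0 : ∀ y → nbTotal 1 y ≡ gap 0 y
        nbTotal-1≡gap-0 y = trans (nbTotal-1 y) (sym (gap-0 y))

        nbTotal-2≡gap-1 : ∀ y → nbTotal 2 y ≡ gap 1 y
        nbTotal-2≡gap-1 y = begin
          nbTotal 2 y
            ≡⟨ nbTotal-recurrence 0 y ⟩
          adjacency (nbTotal 1) y - + 3 * adjacency δ y
            ≡⟨ cong (λ t → t - + 3 * adjacency δ y) (adjacency-cong nbTotal-1≡gap-0 y) ⟩
          adjacency (gap 0) y - + 3 * adjacency δ y
            ≡⟨ cong (λ t → t - + 3 * adjacency δ y) (adjacency-sub (Q 2) (Q 0) y) ⟩
          adjacency (Q 2) y - adjacency (Q 0) y - + 3 * adjacency δ y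
            ≡⟨ cong₂ (λ a b → adjacency (Q 2) y - a - + 3 * b) (trans (Q-1 y) (sym (adjacency-cong Q-0 y))) (Q-1 y) ⟨
          adjacency (Q 2) y - Q 1 y - + 3 * Q 1 y
            ≡⟨ regroup (adjacency (Q 2) y) (Q 1 y) ⟩
          adjacency (Q 2) y - + 3 * Q 1 y - Q 1 y
            ≡⟨ cong (λ t → t - Q 1 y) (Q-rec 1 y) ⟨
          gap 1 y
            ∎
          where
          open ≡-Reasoning
          regroup : ∀ a b → a - b - + 3 * b ≡ a - + 3 * b - b
          regroup = solve-∀

      nbTotal≡Chebyshev-gap : ∀ m y → nbTotal (suc m) y ≡ Q (suc (suc m)) y - Q m y
      nbTotal≡Chebyshev-gap = ChebyshevRecurrence-unique (λ m → nbTotal-recurrence (suc m)) gap-ChebyshevRecurrence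
                                nbTotal-1≡gap-0 nbTotal-2≡gap-1

  ∑ : ℕ → (ℕ → ℤ) → ℤ
  ∑ zero    f = + 0
  ∑ (suc n) f = f 0 + ∑ n (λ i → f (suc i))

  sumℤ≡∑ : ∀ n f → sumℤ n f ≡ ∑ n f
  sumℤ≡∑ n f = go n (λ i → i)
    where
    go : ∀ n (g : ℕ → ℕ) → foldr _+_ (+ 0) (map f (applyUpTo g n)) ≡ ∑ n (λ i → f (g i))
    go zero    g = refl
    go (suc n) g = cong (λ t → f (g 0) + t) (go n (λ i → g (suc i)))

  ∑-cong-< : ∀ n {f g : ℕ → ℤ} → (∀ i → i ℕ.< n → f i ≡ g i) → ∑ n f ≡ ∑ n g
  ∑-cong-< zero    f≡g = refl
  ∑-cong-< (suc n) f≡g = cong₂ _+_ (f≡g 0 (s≤s z≤n)) (∑-cong-< n (λ i i<n → f≡g (suc i) (s≤s i<n)))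

  ∑-cong : ∀ n {f g : ℕ → ℤ} → (∀ i → f i ≡ g i) → ∑ n f ≡ ∑ n g
  ∑-cong n f≡g = ∑-cong-< n (λ i _ → f≡g i)

  sumℤ-cong : ∀ n {f g : ℕ → ℤ} → (∀ i → f i ≡ g i) → sumℤ n f ≡ sumℤ n g
  sumℤ-cong n {f} {g} f≡g = trans (sumℤ≡∑ n f) (trans (∑-cong n f≡g) (sym (sumℤ≡∑ n g)))

  ∑-last : ∀ n f → ∑ (suc n) f ≡ ∑ n f + f n
  ∑-last zero    f = trans (ℤ.+-identityʳ (f 0)) (sym (ℤ.+-identityˡ (f 0)))
  ∑-last (suc n) f = trans (cong (λ t → f 0 + t) (∑-last n (λ i → f (suc i)))) (sym (ℤ.+-assoc (f 0) _ _))

  ∑-last-zero : ∀ n f → f n ≡ + 0 → ∑ (suc n) f ≡ ∑ n f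
  ∑-last-zero n f fn≡0 = trans (∑-last n f) (trans (cong (λ t → ∑ n f + t) fn≡0) (ℤ.+-identityʳ _))

  ∑-zero : ∀ n (f : ℕ → ℤ) → (∀ i → f i ≡ + 0) → ∑ n f ≡ + 0
  ∑-zero zero    f f≡0 = refl
  ∑-zero (suc n) f f≡0 = cong₂ _+_ (f≡0 0) (∑-zero n (λ i → f (suc i)) (λ i → f≡0 (suc i)))

  ∑-distrib-+ : ∀ n (f g : ℕ → ℤ) → ∑ n (λ i → f i + g i) ≡ ∑ n f + ∑ n g
  ∑-distrib-+ zero    f g = refl
  ∑-distrib-+ (suc n) f g =
    trans (cong (λ t → f 0 + g 0 + t) (∑-distrib-+ n (λ i → f (suc i)) (λ i → g (suc i))))
          (interchange (f 0) (g 0) _ _)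
    where
    interchange : ∀ a b c e → a + b + (c + e) ≡ a + c + (b + e)
    interchange = solve-∀

  ∑-*-distribˡ : ∀ n c (f : ℕ → ℤ) → ∑ n (λ i → c * f i) ≡ c * ∑ n f
  ∑-*-distribˡ zero    c f = sym (ℤ.*-zeroʳ c)
  ∑-*-distribˡ (suc n) c f =
    trans (cong (λ t → c * f 0 + t) (∑-*-distribˡ n c (λ i → f (suc i)))) (sym (ℤ.*-distribˡ-+ c (f 0) _))

  ∑-++ : ∀ a b f → ∑ (a ℕ.+ b) f ≡ ∑ a f + ∑ b (λ i → f (a ℕ.+ i))
  ∑-++ zero    b f = sym (ℤ.+-identityˡ _)
  ∑-++ (suc a) b f = trans (cong (λ t → f 0 + t) (∑-++ a b (λ i → f (suc i)))) (sym (ℤ.+-assoc (f 0) _ _))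

  ∑-reverse : ∀ n f → ∑ (suc n) f ≡ ∑ (suc n) (λ k → f (n ∸ k))
  ∑-reverse zero    f = refl
  ∑-reverse (suc n) f = begin
    f 0 + ∑ (suc n) (λ i → f (suc i))
      ≡⟨ cong (λ t → f 0 + t) (∑-reverse n (λ i → f (suc i))) ⟩
    f 0 + ∑ (suc n) (λ k → f (suc (n ∸ k)))
      ≡⟨ ℤ.+-comm (f 0) _ ⟩
    ∑ (suc n) (λ k → f (suc (n ∸ k))) + f 0
      ≡⟨ cong₂ _+_ (∑-cong-< (suc n) (λ k k<1+n → cong f (sym (ℕ.+-∸-assoc 1 (ℕ.≤-pred k<1+n)))))
                   (cong f (sym (ℕ.n∸n≡0 (suc n)))) ⟩
    ∑ (suc n) (λ k → f (suc n ∸ k)) + f (suc n ∸ suc n)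
      ≡⟨ ∑-last (suc n) (λ k → f (suc n ∸ k)) ⟨
    ∑ (suc (suc n)) (λ k → f (suc n ∸ k))
      ∎
    where open ≡-Reasoning

  adjacency-∑ : ∀ n (F : ℕ → V → ℤ) y → adjacency (λ z → ∑ n (λ i → F i z)) y ≡ ∑ n (λ i → adjacency (F i) y)
  adjacency-∑ n F y = sym (begin
    ∑ n (λ i → F i (y ⊕ east) + (F i (y ⊕ west) + (F i (y ⊕ north) + F i (y ⊕ south))))
      ≡⟨ ∑-distrib-+ n (λ i → F i (y ⊕ east)) _ ⟩
    ∑ n (λ i → F i (y ⊕ east)) + ∑ n (λ i → F i (y ⊕ west) + (F i (y ⊕ north) + F i (y ⊕ south)))
      ≡⟨ cong (λ t → ∑ n (λ i → F i (y ⊕ east)) + t) (∑-distrib-+ n (λ i → F i (y ⊕ west)) _) ⟩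
    ∑ n (λ i → F i (y ⊕ east)) + (∑ n (λ i → F i (y ⊕ west)) + ∑ n (λ i → F i (y ⊕ north) + F i (y ⊕ south)))
      ≡⟨ cong (λ t → ∑ n (λ i → F i (y ⊕ east)) + (∑ n (λ i → F i (y ⊕ west)) + t))
              (∑-distrib-+ n (λ i → F i (y ⊕ north)) (λ i → F i (y ⊕ south))) ⟩
    adjacency (λ z → ∑ n (λ i → F i z)) y
      ∎)
    where open ≡-Reasoning

  adjacency-* : ∀ c (f : V → ℤ) y → adjacency (λ z → c * f z) y ≡ c * adjacency f y
  adjacency-* c f y = distrib c (f (y ⊕ east)) (f (y ⊕ west)) (f (y ⊕ north)) (f (y ⊕ south))
    where
    distrib : ∀ c a₁ a₂ a₃ a₄ → c * a₁ + (c * a₂ + (c * a₃ + c * a₄)) ≡ c * (a₁ + (a₂ + (a₃ + a₄)))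
    distrib = solve-∀

  -- Chebyshev-type polynomials in the adjacency operator

  C-pascal-diagonal : ∀ m i → (suc m ∸ i) C suc i ≡ (m ∸ i) C i ℕ.+ (m ∸ i) C suc i
  C-pascal-diagonal m i with i ℕ.≤? m
  ... | yes i≤m = trans (cong (_C suc i) (ℕ.+-∸-assoc 1 i≤m)) (sym (nCk+nC[k+1]≡[n+1]C[k+1] (m ∸ i) i))
  ... | no  i≰m = begin
    (suc m ∸ i) C suc i              ≡⟨ cong (_C suc i) (ℕ.m≤n⇒m∸n≡0 m<i) ⟩
    0 C suc i                        ≡⟨ k>n⇒nCk≡0 {0} {suc i} (s≤s z≤n) ⟩
    0                                ≡⟨ cong₂ ℕ._+_ (k>n⇒nCk≡0 {0} {i} (ℕ.≤-trans (s≤s z≤n) m<i))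
                                                    (k>n⇒nCk≡0 {0} {suc i} (s≤s z≤n)) ⟨
    0 C i ℕ.+ 0 C suc i              ≡⟨ cong (λ t → t C i ℕ.+ t C suc i) (ℕ.m≤n⇒m∸n≡0 (ℕ.<⇒≤ m<i)) ⟨
    (m ∸ i) C i ℕ.+ (m ∸ i) C suc i  ∎
    where
    open ≡-Reasoning
    m<i : m ℕ.< i
    m<i = ℕ.≰⇒> i≰m

  adjacency^ : ℕ → (V → ℤ) → V → ℤ
  adjacency^ zero    f = f
  adjacency^ (suc k) f = adjacency (adjacency^ k f)

  chebyshevCoeff : ℕ → ℕ → ℤ
  chebyshevCoeff m i = -3ℤ ^ i * + ((m ∸ i) C i)

  -- Qₘ(A) f for Qₘ(x) = ∑ᵢ (-3)ⁱ (m-i choose i) x^(m-2i).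
  chebyshev : ℕ → (V → ℤ) → V → ℤ
  chebyshev m f y = ∑ (suc m) (λ i → chebyshevCoeff m i * adjacency^ (m ∸ 2 ℕ.* i) f y)

  chebyshevCoeff-vanishes : ∀ m i → m ∸ i ℕ.< i → chebyshevCoeff m i ≡ + 0
  chebyshevCoeff-vanishes m i m∸i<i =
    trans (cong (λ t → -3ℤ ^ i * + t) (k>n⇒nCk≡0 m∸i<i)) (ℤ.*-zeroʳ (-3ℤ ^ i))

  chebyshevCoeff-pascal : ∀ m j →
    chebyshevCoeff (suc (suc m)) (suc j) ≡ -3ℤ * chebyshevCoeff m j + chebyshevCoeff (suc m) (suc j)
  chebyshevCoeff-pascal m j = begin
    -3ℤ * -3ℤ ^ j * + ((suc m ∸ j) C suc j)
      ≡⟨ cong (λ t → -3ℤ * -3ℤ ^ j * + t) (C-pascal-diagonal m j) ⟩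
    -3ℤ * -3ℤ ^ j * + ((m ∸ j) C j ℕ.+ (m ∸ j) C suc j)
      ≡⟨ distrib -3ℤ (-3ℤ ^ j) (+ ((m ∸ j) C j)) (+ ((m ∸ j) C suc j)) ⟩
    -3ℤ * (-3ℤ ^ j * + ((m ∸ j) C j)) + -3ℤ * -3ℤ ^ j * + ((m ∸ j) C suc j)
      ∎
    where
    open ≡-Reasoning
    distrib : ∀ t p a b → t * p * (a + b) ≡ t * (p * a) + t * p * b
    distrib = solve-∀

  -- Truncated subtraction: when m ∸ 2j = 0 the two exponents differ, but then the coefficient vanishes.
  chebyshevCoeff-adjacency-shift : ∀ m j f y →
    chebyshevCoeff (suc m) (suc j) * adjacency^ (suc (suc m ∸ 2 ℕ.* suc j)) f y
      ≡ chebyshevCoeff (suc m) (suc j) * adjacency^ (m ∸ 2 ℕ.* j) f y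
  chebyshevCoeff-adjacency-shift m j f y with m ∸ 2 ℕ.* j in m∸2j≡
  ... | zero  = trans (cong (_* adjacency^ (suc (suc m ∸ 2 ℕ.* suc j)) f y) coeff≡0)
                      (sym (cong (_* adjacency^ 0 f y) coeff≡0))
    where
    coeff≡0 : chebyshevCoeff (suc m) (suc j) ≡ + 0
    coeff≡0 = chebyshevCoeff-vanishes (suc m) (suc j) (s≤s (begin
      m ∸ j               ≤⟨ ℕ.∸-monoˡ-≤ j (ℕ.m∸n≡0⇒m≤n m∸2j≡) ⟩
      2 ℕ.* j ∸ j         ≡⟨ cong (_∸ j) (cong (j ℕ.+_) (ℕ.+-identityʳ j)) ⟩
      j ℕ.+ j ∸ j         ≡⟨ ℕ.m+n∸m≡n j j ⟩
      j                   ∎))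
      where open ℕ.≤-Reasoning
  ... | suc k = cong (λ e → chebyshevCoeff (suc m) (suc j) * adjacency^ (suc e) f y) (begin
      suc m ∸ 2 ℕ.* suc j     ≡⟨ cong (suc m ∸_) (ℕ.*-suc 2 j) ⟩
      m ∸ suc (2 ℕ.* j)       ≡⟨ ℕ.pred[m∸n]≡m∸[1+n] m (2 ℕ.* j) ⟨
      ℕ.pred (m ∸ 2 ℕ.* j)    ≡⟨ cong ℕ.pred m∸2j≡ ⟩
      k                       ∎)
    where open ≡-Reasoning

  chebyshev-ChebyshevRecurrence : ∀ f → ChebyshevRecurrence (λ m → chebyshev m f)
  chebyshev-ChebyshevRecurrence f m y = trans expand-lhs (sym expand-rhs)
    where
    open ≡-Reasoning
    Aᵏf : ℕ → ℤ
    Aᵏf k = adjacency^ k f y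
    X u : ℕ → ℤ
    X j = chebyshevCoeff m j * Aᵏf (m ∸ 2 ℕ.* j)
    u j = chebyshevCoeff (suc m) (suc j) * Aᵏf (m ∸ 2 ℕ.* j)

    pascal-step : ∀ j → chebyshevCoeff (2 ℕ.+ m) (suc j) * Aᵏf (2 ℕ.+ m ∸ 2 ℕ.* suc j) ≡ -3ℤ * X j + u j
    pascal-step j = begin
      chebyshevCoeff (2 ℕ.+ m) (suc j) * Aᵏf (2 ℕ.+ m ∸ 2 ℕ.* suc j)
        ≡⟨ cong₂ (λ c k → c * Aᵏf k) (chebyshevCoeff-pascal m j) (cong (2 ℕ.+ m ∸_) (ℕ.*-suc 2 j)) ⟩
      (-3ℤ * chebyshevCoeff m j + chebyshevCoeff (suc m) (suc j)) * Aᵏf (m ∸ 2 ℕ.* j)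
        ≡⟨ distrib -3ℤ (chebyshevCoeff m j) (chebyshevCoeff (suc m) (suc j)) (Aᵏf (m ∸ 2 ℕ.* j)) ⟩
      -3ℤ * X j + u j
        ∎
      where
      distrib : ∀ t a b x → (t * a + b) * x ≡ t * (a * x) + b * x
      distrib = solve-∀

    expand-lhs : chebyshev (2 ℕ.+ m) f y ≡ Aᵏf (2 ℕ.+ m) + (-3ℤ * chebyshev m f y + ∑ (suc m) u)
    expand-lhs = cong₂ _+_ (ℤ.*-identityˡ (Aᵏf (2 ℕ.+ m))) (begin
      ∑ (2 ℕ.+ m) (λ j → chebyshevCoeff (2 ℕ.+ m) (suc j) * Aᵏf (2 ℕ.+ m ∸ 2 ℕ.* suc j))
        ≡⟨ ∑-cong (2 ℕ.+ m) pascal-step ⟩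
      ∑ (2 ℕ.+ m) (λ j → -3ℤ * X j + u j)
        ≡⟨ ∑-distrib-+ (2 ℕ.+ m) (λ j → -3ℤ * X j) u ⟩
      ∑ (2 ℕ.+ m) (λ j → -3ℤ * X j) + ∑ (2 ℕ.+ m) u
        ≡⟨ cong₂ _+_ (∑-*-distribˡ (2 ℕ.+ m) -3ℤ X) (∑-last-zero (suc m) u u-last≡0) ⟩
      -3ℤ * ∑ (2 ℕ.+ m) X + ∑ (suc m) u
        ≡⟨ cong (λ t → -3ℤ * t + ∑ (suc m) u) (∑-last-zero (suc m) X X-last≡0) ⟩
      -3ℤ * chebyshev m f y + ∑ (suc m) u
        ∎)
      where
      m∸1+m≡0 : m ∸ suc m ≡ 0
      m∸1+m≡0 = ℕ.m≤n⇒m∸n≡0 (ℕ.n≤1+n m)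
      u-last≡0 : u (suc m) ≡ + 0
      u-last≡0 = cong (_* Aᵏf (m ∸ 2 ℕ.* suc m))
        (chebyshevCoeff-vanishes (suc m) (2 ℕ.+ m) (subst (ℕ._< 2 ℕ.+ m) (sym m∸1+m≡0) (s≤s z≤n)))
      X-last≡0 : X (suc m) ≡ + 0
      X-last≡0 = cong (_* Aᵏf (m ∸ 2 ℕ.* suc m))
        (chebyshevCoeff-vanishes m (suc m) (subst (ℕ._< suc m) (sym m∸1+m≡0) (s≤s z≤n)))

    expand-rhs : adjacency (chebyshev (suc m) f) y - + 3 * chebyshev m f y
                 ≡ Aᵏf (2 ℕ.+ m) + (-3ℤ * chebyshev m f y + ∑ (suc m) u)
    expand-rhs = begin
      adjacency (chebyshev (suc m) f) y - + 3 * chebyshev m f y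
        ≡⟨ cong (_- + 3 * chebyshev m f y) (begin
          adjacency (chebyshev (suc m) f) y
            ≡⟨ adjacency-∑ (2 ℕ.+ m) (λ i z → chebyshevCoeff (suc m) i * adjacency^ (suc m ∸ 2 ℕ.* i) f z) y ⟩
          ∑ (2 ℕ.+ m) (λ i → adjacency (λ z → chebyshevCoeff (suc m) i * adjacency^ (suc m ∸ 2 ℕ.* i) f z) y)
            ≡⟨ ∑-cong (2 ℕ.+ m) (λ i → adjacency-* (chebyshevCoeff (suc m) i) (adjacency^ (suc m ∸ 2 ℕ.* i) f) y) ⟩
          ∑ (2 ℕ.+ m) (λ i → chebyshevCoeff (suc m) i * Aᵏf (suc (suc m ∸ 2 ℕ.* i)))
            ≡⟨ cong₂ _+_ (ℤ.*-identityˡ (Aᵏf (2 ℕ.+ m)))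
                         (∑-cong (suc m) (λ j → chebyshevCoeff-adjacency-shift m j f y)) ⟩
          Aᵏf (2 ℕ.+ m) + ∑ (suc m) u
            ∎) ⟩
      Aᵏf (2 ℕ.+ m) + ∑ (suc m) u - + 3 * chebyshev m f y
        ≡⟨ regroup (Aᵏf (2 ℕ.+ m)) (∑ (suc m) u) (chebyshev m f y) ⟩
      Aᵏf (2 ℕ.+ m) + (-3ℤ * chebyshev m f y + ∑ (suc m) u)
        ∎
      where
      regroup : ∀ a s c → a + s - + 3 * c ≡ a + (-[1+ 2 ] * c + s)
      regroup = solve-∀

  chebyshev-0 : ∀ f y → chebyshev 0 f y ≡ f y
  chebyshev-0 f y = trans (ℤ.+-identityʳ _) (ℤ.*-identityˡ (f y))

  chebyshev-1 : ∀ f y → chebyshev 1 f y ≡ adjacency f y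
  chebyshev-1 f y = trans (ℤ.+-identityʳ _) (ℤ.*-identityˡ (adjacency f y))

  -- Walks in rotated coordinates

  lineWalks : ℕ → ℤ → ℕ
  lineWalks zero    u = indicator (u ℤ.≟ + 0)
  lineWalks (suc k) u = lineWalks k (u - + 1) ℕ.+ lineWalks k (u + + 1)

  lineWalks-too-far : ∀ k t → lineWalks k (- + k - + suc t) ≡ 0
  lineWalks-too-far zero    t = refl
  lineWalks-too-far (suc k) t = cong₂ ℕ._+_
    (trans (cong (lineWalks k) (shift₂ (+ k) (+ t))) (lineWalks-too-far k (suc (suc t))))
    (trans (cong (lineWalks k) (shift₀ (+ k) (+ t))) (lineWalks-too-far k t))
    where
    shift₂ : ∀ K T → - (+ 1 + K) - (+ 1 + T) - + 1 ≡ - K - (+ 1 + (+ 1 + (+ 1 + T)))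
    shift₂ = solve-∀
    shift₀ : ∀ K T → - (+ 1 + K) - (+ 1 + T) + + 1 ≡ - K - (+ 1 + T)
    shift₀ = solve-∀

  -- A ±1 walk of length k from 2j - k to 0 takes exactly j down-steps.
  lineWalks-binomial : ∀ k j → lineWalks k (+ j + + j - + k) ≡ k C j
  lineWalks-binomial zero    zero    = refl
  lineWalks-binomial zero    (suc j) = refl
  lineWalks-binomial (suc k) zero    = cong₂ ℕ._+_
    (trans (cong (lineWalks k) (shift₂ (+ k))) (lineWalks-too-far k 1))
    (trans (cong (lineWalks k) (shift₀ (+ k))) (lineWalks-binomial k 0))
    where
    shift₂ : ∀ K → + 0 + + 0 - (+ 1 + K) - + 1 ≡ - K - (+ 1 + + 1)
    shift₂ = solve-∀
    shift₀ : ∀ K → + 0 + + 0 - (+ 1 + K) + + 1 ≡ + 0 + + 0 - K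
    shift₀ = solve-∀
  lineWalks-binomial (suc k) (suc j) = trans (cong₂ ℕ._+_
      (trans (cong (lineWalks k) (shift₂ (+ k) (+ j))) (lineWalks-binomial k j))
      (trans (cong (lineWalks k) (shift₀ (+ k) (+ j))) (lineWalks-binomial k (suc j))))
    (nCk+nC[k+1]≡[n+1]C[k+1] k j)
    where
    shift₂ : ∀ K J → (+ 1 + J) + (+ 1 + J) - (+ 1 + K) - + 1 ≡ J + J - K
    shift₂ = solve-∀
    shift₀ : ∀ K J → (+ 1 + J) + (+ 1 + J) - (+ 1 + K) + + 1 ≡ (+ 1 + J) + (+ 1 + J) - K
    shift₀ = solve-∀

  indicator-× : ∀ {P Q R : Set} (p : Dec P) (q : Dec Q) (r : Dec R) →
    P ⇔ (Q × R) → indicator p ≡ indicator q ℕ.* indicator r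
  indicator-× (yes _)  (yes _)  (yes _)  _  = refl
  indicator-× (yes p)  (no ¬q)  _        P⇔ = ⊥-elim (¬q (proj₁ (Equivalence.to P⇔ p)))
  indicator-× (yes p)  (yes _)  (no ¬r)  P⇔ = ⊥-elim (¬r (proj₂ (Equivalence.to P⇔ p)))
  indicator-× (no ¬p)  (yes q)  (yes r)  P⇔ = ⊥-elim (¬p (Equivalence.from P⇔ (q , r)))
  indicator-× (no _)   (no _)   _        _  = refl
  indicator-× (no _)   (yes _)  (no _)   _  = refl

  double≡0⇒≡0 : ∀ a → a + a ≡ + 0 → a ≡ + 0
  double≡0⇒≡0 (+ zero) _ = refl

  module Rotated (v : V) where

    open Counting v using (δ)

    α β : V → ℤ
    α (a , b) = (a - proj₁ v) + (b - proj₂ v)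
    β (a , b) = (a - proj₁ v) - (b - proj₂ v)

    ≡v⇔α≡0×β≡0 : ∀ y → y ≡ v ⇔ (α y ≡ + 0 × β y ≡ + 0)
    ≡v⇔α≡0×β≡0 (a , b) = mk⇔ to from
      where
      to : (a , b) ≡ v → α (a , b) ≡ + 0 × β (a , b) ≡ + 0
      to refl = cancel-add a b , cancel-sub a b
        where
        cancel-add : ∀ a b → (a - a) + (b - b) ≡ + 0
        cancel-add = solve-∀
        cancel-sub : ∀ a b → (a - a) - (b - b) ≡ + 0
        cancel-sub = solve-∀
      from : α (a , b) ≡ + 0 × β (a , b) ≡ + 0 → (a , b) ≡ v
      from (α≡0 , β≡0) = cong₂ _,_ (ℤ.i-j≡0⇒i≡j a (proj₁ v) x≡0) (ℤ.i-j≡0⇒i≡j b (proj₂ v) z≡0)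
        where
        x≡0 : a - proj₁ v ≡ + 0
        x≡0 = double≡0⇒≡0 _ (trans (sum-αβ (a - proj₁ v) (b - proj₂ v)) (cong₂ _+_ α≡0 β≡0))
          where
          sum-αβ : ∀ x z → x + x ≡ (x + z) + (x - z)
          sum-αβ = solve-∀
        z≡0 : b - proj₂ v ≡ + 0
        z≡0 = trans (diff-α (a - proj₁ v) (b - proj₂ v)) (cong₂ _-_ α≡0 x≡0)
          where
          diff-α : ∀ x z → z ≡ (x + z) - x
          diff-α = solve-∀

    α-⊕ : ∀ y d → α (y ⊕ d) ≡ α y + (dx d + dy d)
    α-⊕ (a , b) d = regroup a b (proj₁ v) (proj₂ v) (dx d) (dy d)
      where
      regroup : ∀ a b c e x z → (a + x - c) + (b + z - e) ≡ (a - c) + (b - e) + (x + z)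
      regroup = solve-∀

    β-⊕ : ∀ y d → β (y ⊕ d) ≡ β y + (dx d - dy d)
    β-⊕ (a , b) d = regroup a b (proj₁ v) (proj₂ v) (dx d) (dy d)
      where
      regroup : ∀ a b c e x z → (a + x - c) - (b + z - e) ≡ (a - c) - (b - e) + (x - z)
      regroup = solve-∀

    adjacency^-δ : ∀ k y → adjacency^ k δ y ≡ + (lineWalks k (α y) ℕ.* lineWalks k (β y))
    adjacency^-δ zero y = cong +_ (indicator-× (y ≟V v) (α y ℤ.≟ + 0) (β y ℤ.≟ + 0) (≡v⇔α≡0×β≡0 y))
    adjacency^-δ (suc k) y = begin
      ∑ᵈℤ (λ d → adjacency^ k δ (y ⊕ d))
        ≡⟨ ∑ᵈℤ-cong (λ d → trans (adjacency^-δ k (y ⊕ d))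
                               (cong₂ (λ a b → + (lineWalks k a ℕ.* lineWalks k b)) (α-⊕ y d) (β-⊕ y d))) ⟩
      + (p₊ ℕ.* q₊ ℕ.+ (p₋ ℕ.* q₋ ℕ.+ (p₊ ℕ.* q₋ ℕ.+ p₋ ℕ.* q₊)))
        ≡⟨ cong +_ (factor p₊ p₋ q₊ q₋) ⟩
      + ((p₋ ℕ.+ p₊) ℕ.* (q₋ ℕ.+ q₊))
        ∎
      where
      open ≡-Reasoning
      p₊ = lineWalks k (α y + + 1)
      p₋ = lineWalks k (α y - + 1)
      q₊ = lineWalks k (β y + + 1)
      q₋ = lineWalks k (β y - + 1)
      factor : ∀ a b c e → a ℕ.* c ℕ.+ (b ℕ.* e ℕ.+ (a ℕ.* e ℕ.+ b ℕ.* c)) ≡ (b ℕ.+ a) ℕ.* (e ℕ.+ c)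
      factor = ℕ-Solver.solve-∀

    adjacency^-δ-at-v : ∀ j → adjacency^ (2 ℕ.* j) δ v ≡ + sq ((2 ℕ.* j) C j)
    adjacency^-δ-at-v j = trans (adjacency^-δ (2 ℕ.* j) v)
      (cong +_ (cong₂ ℕ._*_ (at-origin (proj₁ (Equivalence.to (≡v⇔α≡0×β≡0 v) refl)))
                            (at-origin (proj₂ (Equivalence.to (≡v⇔α≡0×β≡0 v) refl)))))
      where
      2j-2j≡0 : + j + + j - + (2 ℕ.* j) ≡ + 0
      2j-2j≡0 = trans (cong (λ t → + j + + j - t) (ℤ.pos-* 2 j)) (cancel (+ j))
        where
        cancel : ∀ J → J + J - + 2 * J ≡ + 0
        cancel = solve-∀
      at-origin : ∀ {u} → u ≡ + 0 → lineWalks (2 ℕ.* j) u ≡ (2 ℕ.* j) C j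
      at-origin u≡0 = trans (cong (lineWalks (2 ℕ.* j)) (trans u≡0 (sym 2j-2j≡0))) (lineWalks-binomial (2 ℕ.* j) j)

  -- The two closed forms

  term₁ : ℕ → ℕ → ℤ
  term₁ n i = -3ℤ ^ i * + (((2 ℕ.* n ∸ i) C i) ℕ.* sq ((2 ℕ.* n ∸ 2 ℕ.* i) C (n ∸ i)))

  term₂ : ℕ → ℕ → ℤ
  term₂ n k = -3ℤ ^ (n ∸ k) * + (((n ℕ.+ k) C (2 ℕ.* k)) ℕ.* sq ((2 ℕ.* k) C k))

  sum₁ sum₂ : ℕ → ℤ
  sum₁ n = sumℤ (suc n) (term₁ n)
  sum₂ n = sumℤ (suc n) (term₂ n)

  term₁-vanishes : ∀ n i → term₁ n (suc n ℕ.+ i) ≡ + 0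
  term₁-vanishes n i = trans
    (cong (λ t → -3ℤ ^ (suc n ℕ.+ i) * + (t ℕ.* sq ((2 ℕ.* n ∸ 2 ℕ.* (suc n ℕ.+ i)) C (n ∸ (suc n ℕ.+ i)))))
          (k>n⇒nCk≡0 {2 ℕ.* n ∸ (suc n ℕ.+ i)} {suc n ℕ.+ i} too-large))
    (ℤ.*-zeroʳ (-3ℤ ^ (suc n ℕ.+ i)))
    where
    too-large : 2 ℕ.* n ∸ (suc n ℕ.+ i) ℕ.< suc n ℕ.+ i
    too-large = s≤s (begin
      2 ℕ.* n ∸ (suc n ℕ.+ i)  ≤⟨ ℕ.∸-monoʳ-≤ (2 ℕ.* n) (ℕ.≤-trans (ℕ.n≤1+n n) (ℕ.m≤m+n (suc n) i)) ⟩
      n ℕ.+ (n ℕ.+ 0) ∸ n      ≡⟨ ℕ.m+n∸m≡n n (n ℕ.+ 0) ⟩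
      n ℕ.+ 0                  ≡⟨ ℕ.+-identityʳ n ⟩
      n                        ≤⟨ ℕ.m≤m+n n i ⟩
      n ℕ.+ i                  ∎)
      where open ℕ.≤-Reasoning

  formula₁-telescopes : ∀ n → formula₁ (suc n) ≡ sum₁ (suc n) - sum₁ n
  formula₁-telescopes n = cong (λ t → sum₁ (suc n) - t) (sumℤ-cong (suc n) λ i →
    cong₂ (λ a b → -3ℤ ^ i * + ((a C i) ℕ.* sq b))
          (trans (ℕ.∸-+-assoc (2 ℕ.* suc n) i 2) (cong₂ _∸_ (ℕ.*-suc 2 n) (ℕ.+-comm i 2)))
          (cong₂ _C_ (trans (ℕ.∸-+-assoc (2 ℕ.* suc n) (2 ℕ.* i) 2) (cong₂ _∸_ (ℕ.*-suc 2 n) (ℕ.+-comm (2 ℕ.* i) 2)))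
                     (trans (ℕ.∸-+-assoc (suc n) i 1) (cong (suc n ∸_) (ℕ.+-comm i 1)))))

  formula₂-telescopes : ∀ n → formula₂ (suc n) ≡ sum₂ (suc n) - sum₂ n
  formula₂-telescopes n = cong (λ t → sum₂ (suc n) - t) (sumℤ-cong (suc n) λ j →
    cong₂ (λ a b → -3ℤ ^ (n ∸ j) * + ((a C b) ℕ.* sq (b C j)))
          (cong (_∸ 1) (ℕ.+-suc n j)) (cong (_∸ 2) (ℕ.*-suc 2 j)))

  term₁-reflect : ∀ r k → term₁ (r ℕ.+ k) r ≡ term₂ (r ℕ.+ k) k
  term₁-reflect r k =
    cong₂ (λ e t → -3ℤ ^ e * + t) (sym (ℕ.m+n∸n≡m r k)) (cong₂ (λ a b → a ℕ.* sq b) outer central)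
    where
    open ≡-Reasoning
    outer : (2 ℕ.* (r ℕ.+ k) ∸ r) C r ≡ (r ℕ.+ k ℕ.+ k) C (2 ℕ.* k)
    outer = begin
      (2 ℕ.* (r ℕ.+ k) ∸ r) C r              ≡⟨ cong (λ t → (t ∸ r) C r) (double r k) ⟩
      (r ℕ.+ (r ℕ.+ 2 ℕ.* k) ∸ r) C r        ≡⟨ cong (_C r) (ℕ.m+n∸m≡n r (r ℕ.+ 2 ℕ.* k)) ⟩
      (r ℕ.+ 2 ℕ.* k) C r                    ≡⟨ nCk≡nC[n∸k] (ℕ.m≤m+n r (2 ℕ.* k)) ⟩
      (r ℕ.+ 2 ℕ.* k) C (r ℕ.+ 2 ℕ.* k ∸ r)  ≡⟨ cong₂ _C_ (regroup r k) (ℕ.m+n∸m≡n r (2 ℕ.* k)) ⟩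
      (r ℕ.+ k ℕ.+ k) C (2 ℕ.* k)            ∎
      where
      double : ∀ r k → 2 ℕ.* (r ℕ.+ k) ≡ r ℕ.+ (r ℕ.+ 2 ℕ.* k)
      double = ℕ-Solver.solve-∀
      regroup : ∀ r k → r ℕ.+ 2 ℕ.* k ≡ r ℕ.+ k ℕ.+ k
      regroup = ℕ-Solver.solve-∀
    central : (2 ℕ.* (r ℕ.+ k) ∸ 2 ℕ.* r) C (r ℕ.+ k ∸ r) ≡ (2 ℕ.* k) C k
    central = cong₂ _C_ (trans (cong (_∸ 2 ℕ.* r) (ℕ.*-distribˡ-+ 2 r k)) (ℕ.m+n∸m≡n (2 ℕ.* r) (2 ℕ.* k)))
                        (ℕ.m+n∸m≡n r k)

  sum₁≡sum₂ : ∀ n → sum₁ n ≡ sum₂ n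
  sum₁≡sum₂ n = begin
    sumℤ (suc n) (term₁ n)                 ≡⟨ sumℤ≡∑ (suc n) (term₁ n) ⟩
    ∑ (suc n) (term₁ n)                    ≡⟨ ∑-reverse n (term₁ n) ⟩
    ∑ (suc n) (λ k → term₁ n (n ∸ k))      ≡⟨ ∑-cong-< (suc n) (λ k k<1+n → reflect k (ℕ.≤-pred k<1+n)) ⟩
    ∑ (suc n) (term₂ n)                    ≡⟨ sumℤ≡∑ (suc n) (term₂ n) ⟨
    sumℤ (suc n) (term₂ n)                 ∎
    where
    open ≡-Reasoning
    reflect : ∀ k → k ℕ.≤ n → term₁ n (n ∸ k) ≡ term₂ n k
    reflect k k≤n = subst (λ m → term₁ m (m ∸ k) ≡ term₂ m k) (ℕ.m∸n+n≡m k≤n)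
      (trans (cong (term₁ (n ∸ k ℕ.+ k)) (ℕ.m+n∸n≡m (n ∸ k) k)) (term₁-reflect (n ∸ k) k))

  formula₁≡formula₂ : ∀ n → formula₁ n ≡ formula₂ n
  formula₁≡formula₂ zero    = refl
  formula₁≡formula₂ (suc n) = begin
    formula₁ (suc n)           ≡⟨ formula₁-telescopes n ⟩
    sum₁ (suc n) - sum₁ n      ≡⟨ cong₂ _-_ (sum₁≡sum₂ (suc n)) (sum₁≡sum₂ n) ⟩
    sum₂ (suc n) - sum₂ n      ≡⟨ formula₂-telescopes n ⟨
    formula₂ (suc n)           ∎
    where open ≡-Reasoning

  module EvenLength (v : V) where

    open Enumeration v using (nbCount)
    open Counting v using (δ; nbTotal≡Chebyshev-gap)
    open Rotated v using (adjacency^-δ-at-v)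

    chebyshev-δ-at-v : ∀ n → chebyshev (2 ℕ.* n) δ v ≡ sum₁ n
    chebyshev-δ-at-v n = begin
      ∑ (suc (2 ℕ.* n)) (λ i → chebyshevCoeff (2 ℕ.* n) i * adjacency^ (2 ℕ.* n ∸ 2 ℕ.* i) δ v)
        ≡⟨ ∑-cong (suc (2 ℕ.* n)) summand ⟩
      ∑ (suc (2 ℕ.* n)) (term₁ n)
        ≡⟨ cong (λ k → ∑ (suc k) (term₁ n)) (cong (n ℕ.+_) (ℕ.+-identityʳ n)) ⟩
      ∑ (suc n ℕ.+ n) (term₁ n)
        ≡⟨ ∑-++ (suc n) n (term₁ n) ⟩
      ∑ (suc n) (term₁ n) + ∑ n (λ i → term₁ n (suc n ℕ.+ i))
        ≡⟨ cong (λ t → ∑ (suc n) (term₁ n) + t) (∑-zero n _ (term₁-vanishes n)) ⟩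
      ∑ (suc n) (term₁ n) + + 0
        ≡⟨ trans (ℤ.+-identityʳ _) (sym (sumℤ≡∑ (suc n) (term₁ n))) ⟩
      sum₁ n
        ∎
      where
      open ≡-Reasoning
      summand : ∀ i → chebyshevCoeff (2 ℕ.* n) i * adjacency^ (2 ℕ.* n ∸ 2 ℕ.* i) δ v ≡ term₁ n i
      summand i = begin
        -3ℤ ^ i * + ((2 ℕ.* n ∸ i) C i) * adjacency^ (2 ℕ.* n ∸ 2 ℕ.* i) δ v
          ≡⟨ cong (λ k → -3ℤ ^ i * + ((2 ℕ.* n ∸ i) C i) * adjacency^ k δ v) (ℕ.*-distribˡ-∸ 2 n i) ⟨
        -3ℤ ^ i * + ((2 ℕ.* n ∸ i) C i) * adjacency^ (2 ℕ.* (n ∸ i)) δ v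
          ≡⟨ cong (λ t → -3ℤ ^ i * + ((2 ℕ.* n ∸ i) C i) * t) (adjacency^-δ-at-v (n ∸ i)) ⟩
        -3ℤ ^ i * + ((2 ℕ.* n ∸ i) C i) * + sq ((2 ℕ.* (n ∸ i)) C (n ∸ i))
          ≡⟨ ℤ.*-assoc (-3ℤ ^ i) _ _ ⟩
        -3ℤ ^ i * (+ ((2 ℕ.* n ∸ i) C i) * + sq ((2 ℕ.* (n ∸ i)) C (n ∸ i)))
          ≡⟨ cong (λ t → -3ℤ ^ i * t) (ℤ.pos-* ((2 ℕ.* n ∸ i) C i) _) ⟨
        -3ℤ ^ i * + (((2 ℕ.* n ∸ i) C i) ℕ.* sq ((2 ℕ.* (n ∸ i)) C (n ∸ i)))
          ≡⟨ cong (λ k → -3ℤ ^ i * + (((2 ℕ.* n ∸ i) C i) ℕ.* sq (k C (n ∸ i)))) (ℕ.*-distribˡ-∸ 2 n i) ⟩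
        term₁ n i
          ∎

    nbCount-formula₁ : ∀ n → + ∑ᵈ (nbCount (suc (2 ℕ.* n)) v) ≡ formula₁ (suc n)
    nbCount-formula₁ n = begin
      + ∑ᵈ (nbCount (suc (2 ℕ.* n)) v)
        ≡⟨ nbTotal≡Chebyshev-gap (λ m → chebyshev m δ) (chebyshev-ChebyshevRecurrence δ)
                                 (chebyshev-0 δ) (chebyshev-1 δ) (2 ℕ.* n) v ⟩
      chebyshev (2 ℕ.+ 2 ℕ.* n) δ v - chebyshev (2 ℕ.* n) δ v
        ≡⟨ cong₂ _-_ (trans (cong (λ k → chebyshev k δ v) (sym (ℕ.*-suc 2 n))) (chebyshev-δ-at-v (suc n)))
                     (chebyshev-δ-at-v n) ⟩
      sum₁ (suc n) - sum₁ n
        ≡⟨ formula₁-telescopes n ⟨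
      formula₁ (suc n)
        ∎
      where open ≡-Reasoning

open NonBacktracking
open import Data.Nat using (_*_)

lemma9 : (n : ℕ) (v : V) →
    Σ ℕ λ N → HasCount (ClosedNBWalk v (2 * n)) N × (+ N ≡ formula₁ n) × (+ N ≡ formula₂ n)
lemma9 zero    v = 1 , Enumeration.emptyWalk-count v , refl , refl
lemma9 (suc n) v = ∑ᵈ (nbCount (suc (2 * n)) v) , walks , count , trans count (formula₁≡formula₂ (suc n))
  where
  open Enumeration v using (nbCount; closedNBWalks-count)
  walks : HasCount (ClosedNBWalk v (2 * suc n)) (∑ᵈ (nbCount (suc (2 * n)) v))
  walks = subst (λ m → HasCount (ClosedNBWalk v m) (∑ᵈ (nbCount (suc (2 * n)) v))) (sym (ℕ.*-suc 2 n))
                (closedNBWalks-count (suc (2 * n)))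
  count : + ∑ᵈ (nbCount (suc (2 * n)) v) ≡ formula₁ (suc n)
  count = EvenLength.nbCount-formula₁ v n
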